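{- Let $I$ be a finite index set, let $\sigma$ be a counter $I$-signature, and let $\sigma'$ be the simple signature consisting of the predicate and function symbols of $\sigma$. For any counter symbol $\gamma\in\sigma$ and positive integer $m$, there exists a first-order $(I,\sigma')$-formula $\psi_{\gamma,m}$ with one free variable $x$ such that for every graph $G$, every $G$-interpretation $\mathcal{I}$ of $\sigma$, every $I$-tuple $A_I$ of subsets of $V(G)$ and every $v\in V(G)$: $\gamma(\mathcal{I},A_I,v)\ge m$ if and only if $G,\mathcal{I},A_I\models\psi_{\gamma,m}(v)$.
   Context: An $I$-tuple of subsets of $S$ is $A_I=\{A_i:i\in I\}$ with $A_i\subseteq S$. A term is a variable or a composition of unary function symbols applied to a variable. A counter $I$-signature $\sigma$ consists of unary predicate symbols, unary function symbols, and linearly ordered counter symbols, each counter $\gamma$ having a trigger $(f,\theta)$, where $f$ is a unary function symbol of $\sigma$ and $\theta$ is a quantifier-free formula with the single variable $x$, with no function symbols, built from predicates $X_i$ ($i\in I$), predicate symbols of $\sigma$, equality, and atomic formulas $\gamma'(x)\ge k$ with $\gamma'$ strictly smaller than $\gamma$ and $k$ a positive integer. A simple signature is a set of unary predicate and function symbols; a first-order $(I,\sigma')$-formula is a first-order formula with quantification over vertices, equality and Boolean connectives (no adjacency predicate), using $X_i$ ($i\in I$) and the symbols of $\sigma'$. For a graph $G$, a $G$-interpretation $\mathcal{I}$ assigns a subset of $V(G)$ to each predicate symbol and to each function symbol a function $f_{\mathcal{I}}:V(G)\to V(G)$ with $f_{\mathcal{I}}(v)=v$ or $f_{\mathcal{I}}(v)$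 adjacent to $v$. Given $A_I$ (interpreting $X_i$ as $A_i$), counter values are defined along the order: for $\gamma$ with trigger $(f,\theta)$, $\gamma(\mathcal{I},A_I,v)$ is the number of $u\in V(G)\setminus\{v\}$ with $f_{\mathcal{I}}(u)=v$ and $\theta(u)$ true. -}

module Defs where

open import Data.Nat using (ℕ; zero; suc; _≤_; _≤ᵇ_)
open import Data.Fin using (Fin)
open import Data.Fin.Properties using (_≟_)
open import Data.Fin.Subset using (Subset; _∈_)
open import Data.Fin.Subset.Properties using (_∈?_)
open import Data.Bool using (Bool; true; false; not; _∧_; _∨_; if_then_else_)
open import Data.List using (List; map; allFin)
open import Data.Nat.ListAction using (sum)
open import Data.Vec using (Vec; lookup; []; _∷_; _∷ʳ_)
open import Data.Product using (Σ; _×_; _,_; proj₁; proj₂)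
open import Data.Sum using (_⊎_)
open import Data.Unit using (⊤)
open import Data.Empty using (⊥)
open import Relation.Nullary using (¬_; does)
open import Relation.Binary.PropositionalEquality using (_≡_)

record Graph : Set₁ where
  field
    n      : ℕ
    Adj    : Fin n → Fin n → Set
    sym    : ∀ {u v} → Adj u v → Adj v u
    irrefl : ∀ {v} → ¬ Adj v v
open Graph public

-- Quantifier-free trigger formulas θ in the single variable x.
-- k = |I| (index set I = Fin k), p = number of predicate symbols,
-- j = number of counters strictly smaller than the counter being defined.

data QF (k p j : ℕ) : Set where
  X     : Fin k → QF k p j
  P     : Fin p → QF k p j
  eqxx  : QF k p j
  cnt≥  : Fin j → (m : ℕ) → 1 ≤ m → QF k p j
  qtrue qfalse : QF k p j
  qnot  : QF k p j → QF k p j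
  qand qor : QF k p j → QF k p j → QF k p j

-- Linearly ordered counters, listed from smallest to largest; the j-th
-- counter (0-based) has a trigger (f , θ) with θ only mentioning the j
-- smaller counters.
data Counters (k p q : ℕ) : ℕ → Set where
  []  : Counters k p q 0
  _▷_ : ∀ {j} → Counters k p q j → Fin q × QF k p j → Counters k p q (suc j)

record CSig (k : ℕ) : Set where
  field
    p q c    : ℕ
    counters : Counters k p q c
open CSig public

-- G-interpretations of σ (equivalently of σ', which has the same
-- predicate and function symbols).

record Interp {k : ℕ} (σ : CSig k) (G : Graph) : Set where
  field
    pred  : Fin (p σ) → Subset (n G)
    fun   : Fin (q σ) → Fin (n G) → Fin (n G)
    guard : ∀ f v → fun f v ≡ v ⊎ Adj G v (fun f v)
open Interp public

module _ {k : ℕ} (σ : CSig k) (G : Graph) (ℐ : Interp σ G)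
         (A : Fin k → Subset (n G)) where

  evalQF : ∀ {j} → QF k (p σ) j → Vec (Fin (n G) → ℕ) j → Fin (n G) → Bool
  evalQF (X i)        vs u = does (u ∈? A i)
  evalQF (P r)        vs u = does (u ∈? pred ℐ r)
  evalQF eqxx         vs u = does (u ≟ u)
  evalQF (cnt≥ g m _) vs u = m ≤ᵇ lookup vs g u
  evalQF qtrue        vs u = true
  evalQF qfalse       vs u = false
  evalQF (qnot θ)     vs u = not (evalQF θ vs u)
  evalQF (qand θ θ')  vs u = evalQF θ vs u ∧ evalQF θ' vs u
  evalQF (qor θ θ')   vs u = evalQF θ vs u ∨ evalQF θ' vs u

  triggerCount : ∀ {j} → Fin (q σ) × QF k (p σ) j → Vec (Fin (n G) → ℕ) j
               → Fin (n G) → ℕ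
  triggerCount (f , θ) vs v =
    sum (map (λ u → if not (does (u ≟ v)) ∧ does (fun ℐ f u ≟ v) ∧ evalQF θ vs u
                    then 1 else 0)
             (allFin (n G)))

  counterVals : ∀ {j} → Counters k (p σ) (q σ) j → Vec (Fin (n G) → ℕ) j
  counterVals []       = []
  counterVals (cs ▷ t) = counterVals cs ∷ʳ triggerCount t (counterVals cs)

  counterValue : Fin (c σ) → Fin (n G) → ℕ
  counterValue γ = lookup (counterVals (counters σ)) γ

-- First-order (I,σ')-formulas, de Bruijn variables, no adjacency predicate.

data Term (q v : ℕ) : Set where
  var : Fin v → Term q v
  app : Fin q → Term q v → Term q v

data Formula (k p q : ℕ) : ℕ → Set where
  _≐_   : ∀ {v} → Term q v → Term q v → Formula k p q v
  X     : ∀ {v} → Fin k → Term q v → Formula k p q v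
  P     : ∀ {v} → Fin p → Term q v → Formula k p q v
  ftrue ffalse : ∀ {v} → Formula k p q v
  fnot  : ∀ {v} → Formula k p q v → Formula k p q v
  fand for fimp : ∀ {v} → Formula k p q v → Formula k p q v → Formula k p q v
  fex fall : ∀ {v} → Formula k p q (suc v) → Formula k p q v

module _ {k : ℕ} (σ : CSig k) (G : Graph) (ℐ : Interp σ G)
         (A : Fin k → Subset (n G)) where

  evalTerm : ∀ {v} → Term (q σ) v → Vec (Fin (n G)) v → Fin (n G)
  evalTerm (var i)   ρ = lookup ρ i
  evalTerm (app f t) ρ = fun ℐ f (evalTerm t ρ)

  Sat : ∀ {v} → Formula k (p σ) (q σ) v → Vec (Fin (n G)) v → Set
  Sat (t ≐ t')     ρ = evalTerm t ρ ≡ evalTerm t' ρ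
  Sat (X i t)      ρ = evalTerm t ρ ∈ A i
  Sat (P r t)      ρ = evalTerm t ρ ∈ pred ℐ r
  Sat ftrue        ρ = ⊤
  Sat ffalse       ρ = ⊥
  Sat (fnot φ)     ρ = ¬ Sat φ ρ
  Sat (fand φ ψ)   ρ = Sat φ ρ × Sat ψ ρ
  Sat (for φ ψ)    ρ = Sat φ ρ ⊎ Sat ψ ρ
  Sat (fimp φ ψ)   ρ = Sat φ ρ → Sat ψ ρ
  Sat (fex φ)      ρ = Σ (Fin (n G)) λ u → Sat φ (u ∷ ρ)
  Sat (fall φ)     ρ = (u : Fin (n G)) → Sat φ (u ∷ ρ)

-- For every counter γ and threshold m we build, by recursion along the counter
-- order, a formula ψ_{γ,m}(t) saying γ(t) ≥ m, for an arbitrary term t in an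
-- arbitrary context. The trigger θ translates connective by connective, each
-- atom γ'(x) ≥ m' becoming the formula already built for the smaller counter
-- γ'; and "at least m vertices u ≠ t with f(u) = t and θ(u)" becomes m nested
-- existentials over pairwise distinct witnesses, read off a count by peeling one
-- witness at a time. Building the formulas over terms rather than one fixed
-- variable is what lets them be reused under the new quantifiers.
module Submission where

open import Defs hiding (sym)
open import Data.Nat using (ℕ; zero; suc; _+_; _≤_; _≤ᵇ_; z≤n; s≤s; s≤s⁻¹)
open import Data.Nat.Properties using (≤ᵇ⇒≤; ≤⇒≤ᵇ; +-suc; ≤-trans)
open import Data.Nat.ListAction using (sum)
open import Data.Fin using (Fin; zero; suc)
open import Data.Fin.Properties using (_≟_)
open import Data.Fin.Subset using (Subset)
open import Data.Fin.Subset.Properties using (_∈?_)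
open import Data.Bool using (Bool; true; false; not; _∧_; if_then_else_; T)
open import Data.Bool.Properties using (T-∧; T-∨; ∧-assoc)
open import Data.List as List using (List; []; _∷_; tabulate; allFin)
open import Data.List.Properties using (map-tabulate)
open import Data.Vec using (Vec; []; _∷_; _∷ʳ_; lookup)
open import Data.Vec.Relation.Binary.Pointwise.Inductive as Pointwise
  using (Pointwise; []; _∷_)
open import Data.Product using (Σ; Σ-syntax; _×_; _,_; map₂)
open import Data.Product.Function.NonDependent.Propositional using (_×-⇔_)
open import Data.Sum.Function.Propositional using (_⊎-⇔_)
open import Data.Unit using (tt)
open import Function using (_∘_)
open import Function.Bundles using (_⇔_; mk⇔; Equivalence)
open import Function.Properties.Equivalence using ()
  renaming (refl to ⇔-refl; sym to ⇔-sym; trans to ⇔-trans)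
open import Function.Related.TypeIsomorphisms using (¬-cong-⇔)
open import Relation.Nullary using (Dec; yes; no; does; ¬_)
open import Relation.Binary.PropositionalEquality
  using (_≡_; refl; sym; trans; cong; cong₂; subst)

open Equivalence using (to; from)

T-not : ∀ {b} → T (not b) ⇔ (¬ T b)
T-not {true}  = mk⇔ (λ ()) (λ ¬tt → ¬tt tt)
T-not {false} = mk⇔ (λ _ ()) (λ _ → tt)

T-does : ∀ {P : Set} (p? : Dec P) → P ⇔ T (does p?)
T-does (yes p) = mk⇔ _ (λ _ → p)
T-does (no ¬p) = mk⇔ ¬p (λ ())

T-not-does : ∀ {P : Set} (p? : Dec P) → (¬ P) ⇔ T (not (does p?))
T-not-does p? = ⇔-trans (¬-cong-⇔ (T-does p?)) (⇔-sym T-not)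

≤⇔≤ᵇ : ∀ {m n} → m ≤ n ⇔ T (m ≤ᵇ n)
≤⇔≤ᵇ {m} {n} = mk⇔ ≤⇒≤ᵇ (≤ᵇ⇒≤ m n)

≡⇒⇔ : ∀ {A B : Set} → A ≡ B → A ⇔ B
≡⇒⇔ refl = ⇔-refl

Σ-⇔ : ∀ {A : Set} {P Q : A → Set} → (∀ x → P x ⇔ Q x) → Σ A P ⇔ Σ A Q
Σ-⇔ P⇔Q = mk⇔ (map₂ (to (P⇔Q _))) (map₂ (from (P⇔Q _)))

count : ∀ N → (Fin N → Bool) → ℕ
count zero    R = 0
count (suc N) R = (if R zero then 1 else 0) + count N (R ∘ suc)

sum-allFin≡count : ∀ N (R : Fin N → Bool) →
  sum (List.map (λ u → if R u then 1 else 0) (allFin N)) ≡ count N R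
sum-allFin≡count N R =
  trans (cong sum (map-tabulate (λ u → u) (λ u → if R u then 1 else 0))) (go N R)
  where
  go : ∀ N (R : Fin N → Bool) → sum (tabulate (λ u → if R u then 1 else 0)) ≡ count N R
  go zero    R = refl
  go (suc N) R = cong ((if R zero then 1 else 0) +_) (go N (R ∘ suc))

count-cong : ∀ N {R R′ : Fin N → Bool} → (∀ u → R u ≡ R′ u) → count N R ≡ count N R′
count-cong zero    R≡R′ = refl
count-cong (suc N) R≡R′ rewrite R≡R′ zero = cong (_ +_) (count-cong N (R≡R′ ∘ suc))

count-witness : ∀ N (R : Fin N → Bool) → 1 ≤ count N R → Σ[ u ∈ Fin N ] T (R u)
count-witness (suc N) R 1≤cnt with R zero in Rzero
... | true  = zero , subst T (sym Rzero) tt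
... | false with count-witness N (R ∘ suc) 1≤cnt
...   | u , Ru = suc u , Ru

count-remove : ∀ N (R : Fin N → Bool) u → T (R u) →
  count N R ≡ suc (count N (λ x → not (does (x ≟ u)) ∧ R x))
count-remove (suc N) R zero Ru with R zero
... | true = refl
count-remove (suc N) R (suc u) Ru =
  trans (cong ((if R zero then 1 else 0) +_) (count-remove N (R ∘ suc) u Ru))
        (+-suc _ _)

suc≤count⇔ : ∀ N (R : Fin N → Bool) {m} →
  suc m ≤ count N R ⇔ (Σ[ u ∈ Fin N ] T (R u) × m ≤ count N (λ x → not (does (x ≟ u)) ∧ R x))
suc≤count⇔ N R {m} = mk⇔ peel unpeel
  where
  peel : suc m ≤ count N R → _
  peel m<cnt with u , Ru ← count-witness N R (≤-trans (s≤s z≤n) m<cnt) =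
    u , Ru , s≤s⁻¹ (subst (suc m ≤_) (count-remove N R u Ru) m<cnt)
  unpeel : _ → suc m ≤ count N R
  unpeel (u , Ru , m≤cnt) = subst (suc m ≤_) (sym (count-remove N R u Ru)) (s≤s m≤cnt)

weaken : ∀ {q w} → Term q w → Term q (suc w)
weaken (var i)   = var (suc i)
weaken (app f t) = app f (weaken t)

Unary : ℕ → ℕ → ℕ → Set
Unary k p q = ∀ {w} → Term q w → Formula k p q w

Binary : ℕ → ℕ → ℕ → Set
Binary k p q = ∀ {w} → Term q w → Term q w → Formula k p q w

Thresholds : ℕ → ℕ → ℕ → Set
Thresholds k p q = ℕ → Unary k p q

distinctFrom : ∀ {k p q w} → Term q w → List (Term q w) → Formula k p q w
distinctFrom s []       = ftrue
distinctFrom s (t ∷ ts) = fand (fnot (s ≐ t)) (distinctFrom s ts)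

atLeast : ∀ {k p q} → Binary k p q → ℕ → ∀ {w} → Term q w → List (Term q w) → Formula k p q w
atLeast φ zero    c ts = ftrue
atLeast φ (suc m) c ts =
  fex (fand (fand (distinctFrom (var zero) (List.map weaken ts)) (φ (weaken c) (var zero)))
            (atLeast φ m (weaken c) (var zero ∷ List.map weaken ts)))

translateQF : ∀ {k p q j} → QF k p j → Vec (Thresholds k p q) j → Unary k p q
translateQF (X i)        ψs t = X i t
translateQF (P r)        ψs t = P r t
translateQF eqxx         ψs t = t ≐ t
translateQF (cnt≥ g m _) ψs t = lookup ψs g m t
translateQF qtrue        ψs t = ftrue
translateQF qfalse       ψs t = ffalse
translateQF (qnot θ)     ψs t = fnot (translateQF θ ψs t)
translateQF (qand θ θ′)  ψs t = fand (translateQF θ ψs t) (translateQF θ′ ψs t)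
translateQF (qor θ θ′)   ψs t = for (translateQF θ ψs t) (translateQF θ′ ψs t)

triggered : ∀ {k p q j} → Fin q → QF k p j → Vec (Thresholds k p q) j → Binary k p q
triggered f θ ψs c u = fand (fnot (u ≐ c)) (fand (app f u ≐ c) (translateQF θ ψs u))

triggerThresholds : ∀ {k p q j} → Fin q × QF k p j → Vec (Thresholds k p q) j → Thresholds k p q
triggerThresholds (f , θ) ψs m c = atLeast (triggered f θ ψs) m c []

counterThresholds : ∀ {k p q j} → Counters k p q j → Vec (Thresholds k p q) j
counterThresholds []       = []
counterThresholds (cs ▷ t) = counterThresholds cs ∷ʳ triggerThresholds t (counterThresholds cs)

_∉ᵇ_ : ∀ {N} → Fin N → List (Fin N) → Bool
u ∉ᵇ []       = true
u ∉ᵇ (x ∷ xs) = not (does (u ≟ x)) ∧ u ∉ᵇ xs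

∷ʳ⁺ : ∀ {A B : Set} {_∼_ : A → B → Set} {j} {xs : Vec A j} {ys : Vec B j} {x y} →
      Pointwise _∼_ xs ys → x ∼ y → Pointwise _∼_ (xs ∷ʳ x) (ys ∷ʳ y)
∷ʳ⁺ []            x∼y = x∼y ∷ []
∷ʳ⁺ (x∼y ∷ xs∼ys) z∼w = x∼y ∷ ∷ʳ⁺ xs∼ys z∼w

module Semantics {k : ℕ} {σ : CSig k} {G : Graph}
                 (ℐ : Interp σ G) (A : Fin k → Subset (n G)) where

  private
    N = n G
    V = Fin N

  ⟦_⟧ : ∀ {w} → Term (q σ) w → Vec V w → V
  ⟦_⟧ = evalTerm σ G ℐ A

  _⊨_ : ∀ {w} → Vec V w → Formula k (p σ) (q σ) w → Set
  ρ ⊨ φ = Sat σ G ℐ A φ ρ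

  ⟦weaken⟧ : ∀ {w} (t : Term (q σ) w) u ρ → ⟦ weaken t ⟧ (u ∷ ρ) ≡ ⟦ t ⟧ ρ
  ⟦weaken⟧ (var i)   u ρ = refl
  ⟦weaken⟧ (app f t) u ρ = cong (fun ℐ f) (⟦weaken⟧ t u ρ)

  map-⟦weaken⟧ : ∀ {w} (ts : List (Term (q σ) w)) u ρ →
    List.map (λ t → ⟦ t ⟧ (u ∷ ρ)) (List.map weaken ts) ≡ List.map (λ t → ⟦ t ⟧ ρ) ts
  map-⟦weaken⟧ []       u ρ = refl
  map-⟦weaken⟧ (t ∷ ts) u ρ = cong₂ _∷_ (⟦weaken⟧ t u ρ) (map-⟦weaken⟧ ts u ρ)

  ⊨distinctFrom⇔ : ∀ {w} (s : Term (q σ) w) ts ρ →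
    ρ ⊨ distinctFrom s ts ⇔ T (⟦ s ⟧ ρ ∉ᵇ List.map (λ t → ⟦ t ⟧ ρ) ts)
  ⊨distinctFrom⇔ s []       ρ = ⇔-refl
  ⊨distinctFrom⇔ s (t ∷ ts) ρ =
    ⇔-trans (T-not-does (⟦ s ⟧ ρ ≟ ⟦ t ⟧ ρ) ×-⇔ ⊨distinctFrom⇔ s ts ρ) (⇔-sym T-∧)

  module _ {φ : Binary k (p σ) (q σ)} (B : V → V → Bool)
           (⊨φ⇔ : ∀ {w} (c u : Term (q σ) w) ρ → ρ ⊨ φ c u ⇔ T (B (⟦ c ⟧ ρ) (⟦ u ⟧ ρ))) where

    ⊨atLeast⇔ : ∀ m {w} (c : Term (q σ) w) ts ρ {v vs} →
      ⟦ c ⟧ ρ ≡ v → List.map (λ t → ⟦ t ⟧ ρ) ts ≡ vs →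
      ρ ⊨ atLeast φ m c ts ⇔ (m ≤ count N (λ u → u ∉ᵇ vs ∧ B v u))
    ⊨atLeast⇔ zero    c ts ρ _    _     = mk⇔ (λ _ → z≤n) (λ _ → tt)
    ⊨atLeast⇔ (suc m) c ts ρ {v} {vs} refl refl =
      ⇔-trans (Σ-⇔ λ u → ⊨candidate⇔ u ×-⇔ ⇔-trans (⊨rest⇔ u) (count-≤⇔ u))
              (⇔-sym (suc≤count⇔ N (λ u → u ∉ᵇ vs ∧ B v u)))
      where
      ⊨candidate⇔ : ∀ u →
        (u ∷ ρ) ⊨ fand (distinctFrom (var zero) (List.map weaken ts)) (φ (weaken c) (var zero))
          ⇔ T (u ∉ᵇ vs ∧ B v u)
      ⊨candidate⇔ u = ⇔-trans (distinct ×-⇔ φ-holds) (⇔-sym T-∧)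
        where
        distinct : (u ∷ ρ) ⊨ distinctFrom (var zero) (List.map weaken ts) ⇔ T (u ∉ᵇ vs)
        distinct = ⇔-trans (⊨distinctFrom⇔ (var zero) (List.map weaken ts) (u ∷ ρ))
                           (≡⇒⇔ (cong (λ us → T (u ∉ᵇ us)) (map-⟦weaken⟧ ts u ρ)))
        φ-holds : (u ∷ ρ) ⊨ φ (weaken c) (var zero) ⇔ T (B v u)
        φ-holds = ⇔-trans (⊨φ⇔ (weaken c) (var zero) (u ∷ ρ))
                          (≡⇒⇔ (cong (λ c′ → T (B c′ u)) (⟦weaken⟧ c u ρ)))
      ⊨rest⇔ : ∀ u → (u ∷ ρ) ⊨ atLeast φ m (weaken c) (var zero ∷ List.map weaken ts)
                    ⇔ (m ≤ count N (λ x → x ∉ᵇ (u ∷ vs) ∧ B v x))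
      ⊨rest⇔ u = ⊨atLeast⇔ m (weaken c) _ (u ∷ ρ) (⟦weaken⟧ c u ρ) (cong (u ∷_) (map-⟦weaken⟧ ts u ρ))
      count-≤⇔ : ∀ u → (m ≤ count N (λ x → x ∉ᵇ (u ∷ vs) ∧ B v x))
                     ⇔ (m ≤ count N (λ x → not (does (x ≟ u)) ∧ (x ∉ᵇ vs ∧ B v x)))
      count-≤⇔ u =
        ≡⇒⇔ (cong (m ≤_) (count-cong N (λ x → ∧-assoc (not (does (x ≟ u))) (x ∉ᵇ vs) (B v x))))

  Expresses : Thresholds k (p σ) (q σ) → (V → ℕ) → Set
  Expresses ψ val = ∀ m {w} (t : Term (q σ) w) ρ → ρ ⊨ ψ m t ⇔ (m ≤ val (⟦ t ⟧ ρ))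

  ⊨translateQF⇔ : ∀ {j} (θ : QF k (p σ) j) {ψs vals} → Pointwise Expresses ψs vals →
    ∀ {w} (t : Term (q σ) w) ρ → ρ ⊨ translateQF θ ψs t ⇔ T (evalQF σ G ℐ A θ vals (⟦ t ⟧ ρ))
  ⊨translateQF⇔ (X i)        ψs≈ t ρ = T-does (⟦ t ⟧ ρ ∈? A i)
  ⊨translateQF⇔ (P r)        ψs≈ t ρ = T-does (⟦ t ⟧ ρ ∈? pred ℐ r)
  ⊨translateQF⇔ eqxx         ψs≈ t ρ = T-does (⟦ t ⟧ ρ ≟ ⟦ t ⟧ ρ)
  ⊨translateQF⇔ (cnt≥ g m _) ψs≈ t ρ = ⇔-trans (Pointwise.lookup ψs≈ g m t ρ) ≤⇔≤ᵇ
  ⊨translateQF⇔ qtrue        ψs≈ t ρ = ⇔-refl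
  ⊨translateQF⇔ qfalse       ψs≈ t ρ = ⇔-refl
  ⊨translateQF⇔ (qnot θ)     ψs≈ t ρ =
    ⇔-trans (¬-cong-⇔ (⊨translateQF⇔ θ ψs≈ t ρ)) (⇔-sym T-not)
  ⊨translateQF⇔ (qand θ θ′)  ψs≈ t ρ =
    ⇔-trans (⊨translateQF⇔ θ ψs≈ t ρ ×-⇔ ⊨translateQF⇔ θ′ ψs≈ t ρ) (⇔-sym T-∧)
  ⊨translateQF⇔ (qor θ θ′)   ψs≈ t ρ =
    ⇔-trans (⊨translateQF⇔ θ ψs≈ t ρ ⊎-⇔ ⊨translateQF⇔ θ′ ψs≈ t ρ) (⇔-sym T-∨)

  triggerThresholds-expresses : ∀ {j} (trigger : Fin (q σ) × QF k (p σ) j) {ψs vals} →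
    Pointwise Expresses ψs vals →
    Expresses (triggerThresholds trigger ψs) (triggerCount σ G ℐ A trigger vals)
  triggerThresholds-expresses (f , θ) {ψs} {vals} ψs≈ m t ρ =
    ⇔-trans (⊨atLeast⇔ B ⊨triggered⇔ m t [] ρ refl refl)
            (≡⇒⇔ (cong (m ≤_) (sym (sum-allFin≡count N (B (⟦ t ⟧ ρ))))))
    where
    B : V → V → Bool
    B v u = not (does (u ≟ v)) ∧ does (fun ℐ f u ≟ v) ∧ evalQF σ G ℐ A θ vals u
    ⊨triggered⇔ : ∀ {w} (c u : Term (q σ) w) ρ →
      ρ ⊨ triggered f θ ψs c u ⇔ T (B (⟦ c ⟧ ρ) (⟦ u ⟧ ρ))
    ⊨triggered⇔ c u ρ =
      ⇔-trans (T-not-does (⟦ u ⟧ ρ ≟ ⟦ c ⟧ ρ)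
               ×-⇔ ⇔-trans (T-does (fun ℐ f (⟦ u ⟧ ρ) ≟ ⟦ c ⟧ ρ) ×-⇔ ⊨translateQF⇔ θ ψs≈ u ρ) (⇔-sym T-∧))
              (⇔-sym T-∧)

  counterThresholds-expresses : ∀ {j} (cs : Counters k (p σ) (q σ) j) →
    Pointwise Expresses (counterThresholds cs) (counterVals σ G ℐ A cs)
  counterThresholds-expresses []       = []
  counterThresholds-expresses (cs ▷ t) =
    ∷ʳ⁺ (counterThresholds-expresses cs) (triggerThresholds-expresses t (counterThresholds-expresses cs))

lemma16 : ∀ {k : ℕ} (σ : CSig k) (γ : Fin (c σ)) (m : ℕ) → 1 ≤ m →
    Σ (Formula k (p σ) (q σ) 1) λ ψ →
      (G : Graph) (ℐ : Interp σ G) (A : Fin k → Subset (n G)) (v : Fin (n G)) →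
      (m ≤ counterValue σ G ℐ A γ v) ⇔ Sat σ G ℐ A ψ (v ∷ [])
lemma16 σ γ m _ = lookup (counterThresholds (counters σ)) γ m (var zero) , λ G ℐ A v →
  let open Semantics ℐ A in
  ⇔-sym (Pointwise.lookup (counterThresholds-expresses (counters σ)) γ m (var zero) (v ∷ []))
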